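{- In the setting of the context, let $\overline{\mathcal{B}}(m,n;r)\subseteq\mathcal{B}(m,n;r)$ satisfy: (1) $\overline{\mathcal{B}}(m,n;r)$ is a disjoint union of sets $\pi_1,\dots,\pi_t$, each $\pi_i$ being the set of all boards in $\mathcal{B}(m,n;r)$ with some fixed board partition; (2) every board in $\mathcal{B}(m,n;r)$ is equivalent under $G$ to some board in $\overline{\mathcal{B}}(m,n;r)$; (3) any two boards of $\overline{\mathcal{B}}(m,n;r)$ that are equivalent under $G$ have the same board partition. Let $K_i\le G$ be the subgroup of all $g\in G$ with $g\cdot \pi_i=\pi_i$, and let $S_i\subseteq\pi_i$ be the set of boards in $\pi_i$ for which a prescribed tiling problem is solvable. Then the total number of boards in $\mathcal{B}(m,n;r)$ for which the tiling problem is solvable equals $\sum_{i=1}^t|S_i|\cdot[G:K_i]$.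
   Context: An $m\times n$ grid has cells $(i,j)$, $1\le i\le m$ (rows, top to bottom), $1\le j\le n$ (columns). A board in $\mathcal{B}(m,n;r)$ ($1\le r\le mn$) is a choice of exactly $r$ blocked cells. The symmetry group $G$ acts on boards: if $m=n>1$, $G=D_4$ (four rotations about the center and reflections in the horizontal, vertical and two diagonal bisecting lines); if $m\ne n$ with $m,n>1$, $G=\{R_0,H,V,R_{180}\}$ (identity, reflections in horizontal and vertical midlines, rotation by 180 degrees); if exactly one of $m,n$ is $1$, $G=\{R_0,R_{180}\}$. Boards are equivalent under $G$ if one is an image of the other under some element of $G$. The grid is divided into disjoint regions such that every element of $G$ maps each region onto a region; the board partition of a board is the tuple of numbers of blocked cells in the regions. A tiling problem is given by a finite list of free polyominoes (connected unions of unit squares, up to rotation and reflection) whose total area is $mn-r$; a board is solvable if its $mn-r$ unblocked cells can be covered exactly, without gaps or overlaps, by copies of the listed polyominoes, each used once. -}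

module Defs where

open import Data.Nat using (ℕ; zero; suc; _+_; _*_; _<_)
open import Data.Nat.Properties using (_≟_)
open import Data.Bool using (Bool; true; false; if_then_else_)
open import Data.Fin using (Fin; toℕ; opposite; cast)
import Data.Fin.Properties as FinP
open import Data.Integer using (ℤ; +_; -_) renaming (_+_ to _+ℤ_)
open import Data.Product using (Σ; ∃; ∃-syntax; _×_; _,_)
open import Data.Sum using (_⊎_)
open import Data.List using (List; []; _∷_; length; map; concat; zipWith; cartesianProduct; allFin; filter)
open import Data.List.Membership.Propositional using (_∈_)
open import Data.List.Relation.Unary.Unique.Propositional using (Unique)
open import Data.Vec using (Vec; lookup; tabulate)
open import Relation.Binary.PropositionalEquality using (_≡_; _≢_; sym)
open import Relation.Nullary using (¬_; yes; no)
open import Function.Bundles using (_⇔_)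

-- Counting: "the number of x : A with P x is N"
-- (a duplicate-free list whose members are exactly the x with P x)

IsCount : (A : Set) → (A → Set) → ℕ → Set
IsCount A P N = Σ (List A) λ L → Unique L × (∀ x → (x ∈ L) ⇔ P x) × length L ≡ N

∑ : (t : ℕ) → (Fin t → ℕ) → ℕ
∑ zero    f = 0
∑ (suc t) f = f Fin.zero + ∑ t (λ i → f (Fin.suc i))

-- Grid, cells (0-indexed: row i, column j), boards

Cell : ℕ → ℕ → Set
Cell m n = Fin m × Fin n

allCells : (m n : ℕ) → List (Cell m n)
allCells m n = cartesianProduct (allFin m) (allFin n)

-- a board: true = blocked cell
Board : ℕ → ℕ → Set
Board m n = Vec (Vec Bool n) m

at : ∀ {m n} → Board m n → Cell m n → Bool
at b (i , j) = lookup (lookup b i) j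

Blocked : ∀ {m n} → Board m n → Cell m n → Set
Blocked b c = at b c ≡ true

blockedCount : ∀ {m n} → Board m n → ℕ
blockedCount {m} {n} b = length (filter (λ c → at b c Data.Bool.≟ true) (allCells m n))
  where import Data.Bool

InB : (m n r : ℕ) → Board m n → Set
InB m n r b = blockedCount b ≡ r

-- R90 = clockwise quarter turn, D = reflection in the main
-- diagonal, A = reflection in the anti-diagonal.  The quarter turns and the
-- diagonal reflections only make sense on square grids; on non-square grids
-- they are (arbitrarily) the identity, but they are never elements of G there.

data Sym : Set where
  R0 R90 R180 R270 H V D A : Sym

act : ∀ {m n} → Sym → Cell m n → Cell m n
act R0   (i , j) = i , j
act H    (i , j) = opposite i , j
act V    (i , j) = i , opposite j
act R180 (i , j) = opposite i , opposite j
act {m} {n} R90 (i , j) with m ≟ n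
... | yes e = cast (sym e) j , opposite (cast e i)
... | no _  = i , j
act {m} {n} R270 (i , j) with m ≟ n
... | yes e = cast (sym e) (opposite j) , cast e i
... | no _  = i , j
act {m} {n} D (i , j) with m ≟ n
... | yes e = cast (sym e) j , cast e i
... | no _  = i , j
act {m} {n} A (i , j) with m ≟ n
... | yes e = cast (sym e) (opposite j) , opposite (cast e i)
... | no _  = i , j

inv : Sym → Sym
inv R90  = R270
inv R270 = R90
inv g    = g

actB : ∀ {m n} → Sym → Board m n → Board m n
actB g b = tabulate λ i → tabulate λ j → at b (act (inv g) (i , j))

data Rect4 : Sym → Set where
  r0 : Rect4 R0
  h  : Rect4 H
  v  : Rect4 V
  r180 : Rect4 R180

data Rot2 : Sym → Set where
  r0 : Rot2 R0
  r180 : Rot2 R180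

data InG (m n : ℕ) (g : Sym) : Set where
  square : m ≡ n → 1 < n → InG m n g
  rect   : m ≢ n → 1 < m → 1 < n → Rect4 g → InG m n g
  line   : (m ≡ 1 × 1 < n) ⊎ (1 < m × n ≡ 1) → Rot2 g → InG m n g
  -- 1 × 1 grid (not covered by the paper; any choice gives the same indices)
  unit   : m ≡ 1 → n ≡ 1 → Rot2 g → InG m n g

Equiv : ∀ {m n} → Board m n → Board m n → Set
Equiv {m} {n} b b' = Σ Sym λ g → InG m n g × actB g b ≡ b'

-- Regions and board partitions.  A division into k regions is a map
-- reg : Cell m n → Fin k (cell c lies in region reg c).

RegionsInvariant : (m n k : ℕ) → (Cell m n → Fin k) → Set
RegionsInvariant m n k reg =
  ∀ g → InG m n g → ∀ (a : Fin k) → Σ (Fin k) λ a' →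
    ∀ (c' : Cell m n) → (reg c' ≡ a') ⇔ (Σ (Cell m n) λ c → reg c ≡ a × act g c ≡ c')

partition : ∀ {m n k} → (Cell m n → Fin k) → Board m n → Vec ℕ k
partition {m} {n} {k} reg b = tabulate λ a →
  length (filter (λ c → FinP._≟_ (reg c) a) (filter (λ c → at b c Data.Bool.≟ true) (allCells m n)))
  where import Data.Bool

-- A polyomino is given by the list of (integer
-- coordinates of) its unit squares; free polyominoes: placements may use
-- any of the 8 rotations/reflections of the plane plus a translation.

Point : Set
Point = ℤ × ℤ

Adj : Point → Point → Set
Adj (x , y) (x' , y') = (x' ≡ x +ℤ + 1 × y' ≡ y) ⊎ (x ≡ x' +ℤ + 1 × y' ≡ y)
                      ⊎ (x' ≡ x × y' ≡ y +ℤ + 1) ⊎ (x' ≡ x × y ≡ y' +ℤ + 1)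

data PathIn (P : List Point) : Point → Point → Set where
  here : ∀ {p} → p ∈ P → PathIn P p p
  step : ∀ {p q s} → p ∈ P → Adj p q → PathIn P q s → PathIn P p s

IsPolyomino : List Point → Set
IsPolyomino P = (Σ Point λ p → p ∈ P) × Unique P × (∀ p q → p ∈ P → q ∈ P → PathIn P p q)

area : List Point → ℕ
area = length

-- the 8 isometries of ℤ² fixing the origin: optional swap of coordinates,
-- then optional negation of each coordinate
PIso : Set
PIso = Bool × Bool × Bool

neg? : Bool → ℤ → ℤ
neg? true  z = - z
neg? false z = z

pact : PIso → Point → Point
pact (true  , a , b) (x , y) = neg? a y , neg? b x
pact (false , a , b) (x , y) = neg? a x , neg? b y

Placement : Set
Placement = PIso × Point

place : Placement → List Point → List Point
place (σ , (dx , dy)) P = map (λ p → let (x , y) = pact σ p in (x +ℤ dx , y +ℤ dy)) P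

cellPoint : ∀ {m n} → Cell m n → Point
cellPoint (i , j) = + toℕ i , + toℕ j

-- the unblocked cells of b are covered exactly (no gaps, no overlaps, nothing
-- outside) by copies of the pieces, each piece used exactly once
Solvable : ∀ {m n} → List (List Point) → Board m n → Set
Solvable {m} {n} pieces b =
  Σ (List Placement) λ pls → length pls ≡ length pieces ×
    let L = concat (zipWith place pls pieces) in
    Unique L × (∀ z → (z ∈ L) ⇔ (Σ (Cell m n) λ c → cellPoint c ≡ z × at b c ≡ false))

{-# OPTIONS --safe #-}
-- Every board of 𝓑(m,n;r) is G-equivalent to a board of B̄ by (2), so it lies in the orbit
-- G·π_i of some class, and that class is unique by (3) and the disjointness of the π_i.
-- Solvability is G-invariant: each grid symmetry is the restriction of an isometry of ℤ²,
-- which carries tilings to tilings. The solvable boards of G·π_i are the image of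
-- (g , b) ↦ g·b on G × S_i, and the fibre over g₀·b₀ is {(g₀k , k⁻¹b₀) : k ∈ K_i}, because a
-- symmetry mapping one board of π_i into π_i stabilises π_i (G permutes the regions, so it
-- acts uniformly on board partitions). Hence |G|·|S_i| = |K_i|·#(solvable boards of G·π_i),
-- and summing |S_i|·[G:K_i] over i counts every solvable board once.
module Submission where

open import Defs
open import Algebra.Bundles using (AbelianGroup)
open import Data.Bool using (Bool; true; false; not; _xor_)
import Data.Bool.Properties as Bool
open import Data.Empty using (⊥-elim)
open import Data.Fin using (Fin; zero; suc; toℕ; opposite)
import Data.Fin.Properties as Fin
open import Data.Fin.Properties using (opposite-involutive; opposite-prop; cast-is-id; toℕ≤pred[n])
open import Data.Integer using (ℤ; +_; -_; _⊖_) renaming (_+_ to _+ℤ_)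
import Data.Integer.Properties as ℤ
open import Algebra.Properties.Group (AbelianGroup.group ℤ.+-0-abelianGroup) using (∙-cancelʳ)
open import Data.List
  using (List; []; _∷_; length; map; filter; cartesianProduct; _++_; concat; zipWith; allFin; tabulate)
open import Data.List.Properties
  using (length-map; length-++; map-∘; map-id-local; map-++; map-cong; map-tabulate)
open import Data.List.Membership.Propositional using (_∈_; find; lose)
open import Data.List.Membership.Propositional.Properties
  using (∈-map⁺; ∈-map⁻; ∈-filter⁺; ∈-filter⁻; ∈-cartesianProduct⁺; ∈-cartesianProduct⁻; ∈-allFin)
open import Data.List.Membership.Propositional.Properties.WithK using (unique∧set⇒bag)
open import Data.List.Relation.Binary.BagAndSetEquality using (∼bag⇒↭)
open import Data.List.Relation.Binary.Permutation.Propositional.Properties using (↭-length)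
open import Data.List.Relation.Unary.All as All using (All; all?)
open import Data.List.Relation.Unary.Any using (here; there; any?)
open import Data.List.Relation.Unary.Unique.Propositional using (Unique; []; _∷_)
import Data.List.Relation.Unary.Unique.Propositional.Properties as Unique
open import Data.Nat using (ℕ; zero; suc; _+_; _*_; _≤_; pred; _∸_; NonZero)
open import Data.Nat.ListAction using (sum)
open import Data.Nat.Properties using (_≟_; <-irrefl; m≤n⇒m<n∨m≡n; *-comm; *-assoc; *-cancelʳ-≡)
import Data.Nat.Properties as ℕ
open import Data.Product using (Σ; ∃; ∃₂; _×_; _,_; proj₁; proj₂)
open import Data.Product.Properties using (≡-dec)
open import Data.Product.Function.NonDependent.Propositional using (_×-⇔_)
open import Data.Sum using (_⊎_; inj₁; inj₂)
open import Data.Unit using (⊤; tt)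
open import Data.Vec using (Vec; lookup)
import Data.Vec.Properties as Vec
open import Data.Vec.Properties using (lookup∘tabulate; tabulate∘lookup; tabulate-cong)
open import Function using (_∘_; id)
open import Function.Bundles using (_⇔_; mk⇔; Equivalence)
import Function.Properties.Equivalence as ⇔
open import Level using (0ℓ)
open import Relation.Nullary using (¬_; Dec; yes; no; map′)
open import Relation.Nullary.Decidable using (from-yes; _×-dec_)
open import Relation.Unary using (Pred; Decidable; _∩_; ∁)
open import Relation.Unary.Properties using (∁?)
open import Relation.Binary.Definitions using (DecidableEquality)
open import Relation.Binary.PropositionalEquality
  using (_≡_; _≢_; refl; sym; trans; cong; cong₂; subst; module ≡-Reasoning)

open Equivalence

-- Counting

module _ {X : Set} where

  IsCount-unique : ∀ {P : Pred X 0ℓ} {n n′} → IsCount X P n → IsCount X P n′ → n ≡ n′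
  IsCount-unique (L , L! , L⇔ , refl) (L′ , L′! , L′⇔ , refl) =
    ↭-length (∼bag⇒↭ (unique∧set⇒bag L! L′! λ {x} → ⇔.trans (L⇔ x) (⇔.sym (L′⇔ x))))

  IsCount-resp : ∀ {P Q : Pred X 0ℓ} {n} → (∀ x → P x ⇔ Q x) → IsCount X P n → IsCount X Q n
  IsCount-resp P⇔Q (L , L! , L⇔ , len) = L , L! , (λ x → ⇔.trans (L⇔ x) (P⇔Q x)) , len

  IsCount-empty : ∀ {P : Pred X 0ℓ} {n} → (∀ x → ¬ P x) → IsCount X P n → n ≡ 0
  IsCount-empty ¬P #P = IsCount-unique #P ([] , [] , (λ x → mk⇔ (λ ()) (⊥-elim ∘ ¬P x)) , refl)

  IsCount-nonZero : ∀ {P : Pred X 0ℓ} {n x} → IsCount X P n → P x → NonZero n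
  IsCount-nonZero {x = x} ([] , _ , L⇔ , refl) Px with () ← from (L⇔ x) Px
  IsCount-nonZero (_ ∷ _ , _ , _ , refl) _ = _

  IsCount-any? : ∀ {P Q : Pred X 0ℓ} {n} → IsCount X P n → Decidable Q → Dec (∃ λ x → P x × Q x)
  IsCount-any? (L , _ , L⇔ , _) Q? = map′
    (λ x∈L×Qx → let x , x∈L , Qx = find x∈L×Qx in x , to (L⇔ x) x∈L , Qx)
    (λ (x , Px , Qx) → lose (from (L⇔ x) Px) Qx)
    (any? Q? L)

  IsCount-filter : ∀ {P Q : Pred X 0ℓ} {n} (Q? : Decidable Q) ((L , _) : IsCount X P n) →
                   IsCount X (P ∩ Q) (length (filter Q? L))
  IsCount-filter Q? (L , L! , L⇔ , _) = filter Q? L , Unique.filter⁺ Q? L! ,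
    (λ x → mk⇔ (λ x∈ → let x∈L , Qx = ∈-filter⁻ Q? x∈ in to (L⇔ x) x∈L , Qx)
               (λ (Px , Qx) → ∈-filter⁺ Q? (from (L⇔ x) Px) Qx)) ,
    refl

  length-filter+length-filter-∁ : ∀ {Q : Pred X 0ℓ} (Q? : Decidable Q) xs →
    length (filter Q? xs) + length (filter (∁? Q?) xs) ≡ length xs
  length-filter+length-filter-∁ Q? [] = refl
  length-filter+length-filter-∁ Q? (x ∷ xs) with Q? x
  ... | yes _ = cong suc (length-filter+length-filter-∁ Q? xs)
  ... | no  _ = trans (ℕ.+-suc _ _) (cong suc (length-filter+length-filter-∁ Q? xs))

  IsCount-split : ∀ {P Q : Pred X 0ℓ} {n} → Decidable Q → IsCount X P n →
    ∃₂ λ n₁ n₂ → IsCount X (P ∩ Q) n₁ × IsCount X (P ∩ ∁ Q) n₂ × n ≡ n₁ + n₂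
  IsCount-split Q? #P@(L , _ , _ , refl) =
    _ , _ , IsCount-filter Q? #P , IsCount-filter (∁? Q?) #P ,
    sym (length-filter+length-filter-∁ Q? L)

  IsCount-partition : ∀ {I : Set} {P : Pred X 0ℓ} {Q : I → Pred X 0ℓ} → (∀ i → Decidable (Q i)) →
    ∀ {n} → IsCount X P n → (is : List I) → Unique is →
    (∀ {x} → P x → ∃ λ i → i ∈ is × Q i x) →
    (∀ {x i j} → P x → Q i x → Q j x → i ≡ j) →
    (c : I → ℕ) → (∀ {i} → i ∈ is → IsCount X (P ∩ Q i) (c i)) →
    n ≡ sum (map c is)
  IsCount-partition {P = P} Q? #P [] _ cover _ _ _ = IsCount-empty uncovered #P
    where
    uncovered : ∀ x → ¬ P x
    uncovered x Px with cover Px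
    ... | _ , () , _
  IsCount-partition {P = P} {Q} Q? #P (i ∷ is) (i∉is ∷ is!) cover disjoint c #P∩Q =
    let _ , _ , #P∩Qi , #P∖Qi , n≡n₁+n₂ = IsCount-split (Q? i) #P in
    trans n≡n₁+n₂ (cong₂ _+_ (IsCount-unique #P∩Qi (#P∩Q (here refl)))
      (IsCount-partition Q? #P∖Qi is is! cover′ (disjoint ∘ proj₁) c #P∖Qi∩Q))
    where
    cover′ : ∀ {x} → (P ∩ ∁ (Q i)) x → ∃ λ j → j ∈ is × Q j x
    cover′ (Px , ¬Qix) with cover Px
    ... | _ , here refl , Qix = ⊥-elim (¬Qix Qix)
    ... | j , there j∈is , Qjx = j , j∈is , Qjx
    #P∖Qi∩Q : ∀ {j} → j ∈ is → IsCount X ((P ∩ ∁ (Q i)) ∩ Q j) (c j)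
    #P∖Qi∩Q j∈is = IsCount-resp (λ x → mk⇔
      (λ (Px , Qjx) → (Px , λ Qix → All.lookup i∉is j∈is (disjoint Px Qix Qjx)) , Qjx)
      (λ ((Px , _) , Qjx) → Px , Qjx))
      (#P∩Q (there j∈is))

sum-map-const : ∀ {X : Set} (xs : List X) κ → sum (map (λ _ → κ) xs) ≡ length xs * κ
sum-map-const []       κ = refl
sum-map-const (_ ∷ xs) κ = cong (_+_ κ) (sum-map-const xs κ)

module _ {X Y : Set} where

  IsCount-bijection : ∀ {P : Pred X 0ℓ} {Q : Pred Y 0ℓ} {n} (f : X → Y) (g : Y → X) →
    (∀ {a} → P a → Q (f a)) → (∀ {b} → Q b → P (g b)) →
    (∀ {a} → P a → g (f a) ≡ a) → (∀ {b} → Q b → f (g b) ≡ b) →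
    IsCount X P n → IsCount Y Q n
  IsCount-bijection {Q = Q} f g fP gQ gf fg (L , L! , L⇔ , len) =
    map f L , Unique.map⁻ (subst Unique (sym g∘f[L]≡L) L!) ,
    (λ b → mk⇔ (λ b∈ → let a , a∈L , b≡fa = ∈-map⁻ f b∈ in subst Q (sym b≡fa) (fP (to (L⇔ a) a∈L)))
               (λ Qb → subst (_∈ map f L) (fg Qb) (∈-map⁺ f (from (L⇔ (g b)) (gQ Qb))))) ,
    trans (length-map f L) len
    where
    g∘f[L]≡L : map g (map f L) ≡ L
    g∘f[L]≡L = trans (sym (map-∘ L)) (map-id-local (All.tabulate λ a∈L → gf (to (L⇔ _) a∈L)))

  length-cartesianProduct : (xs : List X) (ys : List Y) →
    length (cartesianProduct xs ys) ≡ length xs * length ys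
  length-cartesianProduct []       ys = refl
  length-cartesianProduct (x ∷ xs) ys = trans (length-++ (map (x ,_) ys))
    (cong₂ _+_ (length-map (x ,_) ys) (length-cartesianProduct xs ys))

  IsCount-× : ∀ {P : Pred X 0ℓ} {Q : Pred Y 0ℓ} {n₁ n₂} → IsCount X P n₁ → IsCount Y Q n₂ →
    IsCount (X × Y) (λ (a , b) → P a × Q b) (n₁ * n₂)
  IsCount-× (L , L! , L⇔ , refl) (L′ , L′! , L′⇔ , refl) =
    cartesianProduct L L′ , Unique.cartesianProduct⁺ L! L′! ,
    (λ (a , b) → mk⇔
      (λ ab∈ → let a∈L , b∈L′ = ∈-cartesianProduct⁻ L L′ ab∈ in to (L⇔ a) a∈L , to (L′⇔ b) b∈L′)
      (λ (Pa , Qb) → ∈-cartesianProduct⁺ (from (L⇔ a) Pa) (from (L′⇔ b) Qb))) ,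
    length-cartesianProduct L L′

  IsCount-fibres : ∀ {P : Pred X 0ℓ} {Q : Pred Y 0ℓ} {n₁ n₂} κ → DecidableEquality Y → (f : X → Y) →
    IsCount X P n₁ → IsCount Y Q n₂ → (∀ {a} → P a → Q (f a)) →
    (∀ {b} → Q b → IsCount X (λ a → P a × f a ≡ b) κ) →
    n₁ ≡ n₂ * κ
  IsCount-fibres κ _≟_ f #P #Q@(L , L! , L⇔ , refl) PQ #fibre =
    trans (IsCount-partition (λ b a → f a ≟ b) #P L L! (λ Pa → f _ , from (L⇔ _) (PQ Pa) , refl)
                             (λ _ fa≡b fa≡b′ → trans (sym fa≡b) fa≡b′) (λ _ → κ)
                             (λ b∈L → #fibre (to (L⇔ _) b∈L)))
          (sum-map-const L κ)

-- The symmetry group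

-- The linear part of the isometry of ℤ² that g induces on cell coordinates (cellPoint-act).
code : Sym → PIso
code R0   = false , false , false
code R90  = true  , false , true
code R180 = false , true  , true
code R270 = true  , true  , false
code H    = false , true  , false
code V    = false , false , true
code D    = true  , false , false
code A    = true  , true  , true

decode : PIso → Sym
decode (false , false , false) = R0
decode (true  , false , true ) = R90
decode (false , true  , true ) = R180
decode (true  , true  , false) = R270
decode (false , true  , false) = H
decode (false , false , true ) = V
decode (true  , false , false) = D
decode (true  , true  , true ) = A

decode-code : ∀ g → decode (code g) ≡ g
decode-code R0   = refl
decode-code R90  = refl
decode-code R180 = refl
decode-code R270 = refl
decode-code H    = refl
decode-code V    = refl
decode-code D    = refl
decode-code A    = refl

code-injective : ∀ {g g′} → code g ≡ code g′ → g ≡ g′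
code-injective {g} {g′} eq = trans (sym (decode-code g)) (trans (cong decode eq) (decode-code g′))

infix 4 _≟ᴵ_ _≟ˢ_
_≟ᴵ_ : DecidableEquality PIso
_≟ᴵ_ = ≡-dec Bool._≟_ (≡-dec Bool._≟_ Bool._≟_)

_≟ˢ_ : DecidableEquality Sym
g ≟ˢ g′ = map′ code-injective (cong code) (code g ≟ᴵ code g′)

syms : List Sym
syms = R0 ∷ R90 ∷ R180 ∷ R270 ∷ H ∷ V ∷ D ∷ A ∷ []

∈-syms : ∀ g → g ∈ syms
∈-syms R0   = here refl
∈-syms R90  = there (here refl)
∈-syms R180 = there (there (here refl))
∈-syms R270 = there (there (there (here refl)))
∈-syms H    = there (there (there (there (here refl))))
∈-syms V    = there (there (there (there (there (here refl)))))
∈-syms D    = there (there (there (there (there (there (here refl))))))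
∈-syms A    = there (there (there (there (there (there (there (here refl)))))))

∀? : ∀ {P : Sym → Set} → Decidable P → Dec (∀ g → P g)
∀? P? = map′ (λ all g → All.lookup all (∈-syms g)) (λ ∀P → All.tabulate λ {g} _ → ∀P g) (all? P? syms)

infixr 9 _∘ᴵ_
_∘ᴵ_ : PIso → PIso → PIso
(false , a , b) ∘ᴵ (s , a′ , b′) = s     , a xor a′ , b xor b′
(true  , a , b) ∘ᴵ (s , a′ , b′) = not s , a xor b′ , b xor a′

infixl 7 _∙_
_∙_ : Sym → Sym → Sym
g ∙ g′ = decode (code g ∘ᴵ code g′)

code-∙ : ∀ g g′ → code (g ∙ g′) ≡ code g ∘ᴵ code g′
code-∙ = from-yes (∀? λ g → ∀? λ g′ → code (g ∙ g′) ≟ᴵ code g ∘ᴵ code g′)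

∙-inverseˡ : ∀ g → inv g ∙ g ≡ R0
∙-inverseˡ = from-yes (∀? λ g → inv g ∙ g ≟ˢ R0)

∙-inverseʳ : ∀ g → g ∙ inv g ≡ R0
∙-inverseʳ = from-yes (∀? λ g → g ∙ inv g ≟ˢ R0)

inv-anti-homo-∙ : ∀ g g′ → inv (g ∙ g′) ≡ inv g′ ∙ inv g
inv-anti-homo-∙ = from-yes (∀? λ g → ∀? λ g′ → inv (g ∙ g′) ≟ˢ inv g′ ∙ inv g)

∙-inv-cancel : ∀ g g′ → g ∙ (inv g ∙ g′) ≡ g′
∙-inv-cancel = from-yes (∀? λ g → ∀? λ g′ → g ∙ (inv g ∙ g′) ≟ˢ g′)

inv-∙-cancel : ∀ g g′ → inv g ∙ (g ∙ g′) ≡ g′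
inv-∙-cancel = from-yes (∀? λ g → ∀? λ g′ → inv g ∙ (g ∙ g′) ≟ˢ g′)

Rect4-∙ : ∀ {g g′} → Rect4 g → Rect4 g′ → Rect4 (g ∙ g′)
Rect4-∙ r0   r0   = r0
Rect4-∙ r0   h    = h
Rect4-∙ r0   v    = v
Rect4-∙ r0   r180 = r180
Rect4-∙ h    r0   = h
Rect4-∙ h    h    = r0
Rect4-∙ h    v    = r180
Rect4-∙ h    r180 = v
Rect4-∙ v    r0   = v
Rect4-∙ v    h    = r180
Rect4-∙ v    v    = r0
Rect4-∙ v    r180 = h
Rect4-∙ r180 r0   = r180
Rect4-∙ r180 h    = v
Rect4-∙ r180 v    = h
Rect4-∙ r180 r180 = r0

Rot2-∙ : ∀ {g g′} → Rot2 g → Rot2 g′ → Rot2 (g ∙ g′)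
Rot2-∙ r0   r0   = r0
Rot2-∙ r0   r180 = r180
Rot2-∙ r180 r0   = r180
Rot2-∙ r180 r180 = r0

Rect4-inv : ∀ {g} → Rect4 g → Rect4 (inv g)
Rect4-inv r0   = r0
Rect4-inv h    = h
Rect4-inv v    = v
Rect4-inv r180 = r180

Rot2-inv : ∀ {g} → Rot2 g → Rot2 (inv g)
Rot2-inv r0   = r0
Rot2-inv r180 = r180

Rot2⇒Rect4 : ∀ {g} → Rot2 g → Rect4 g
Rot2⇒Rect4 r0   = r0
Rot2⇒Rect4 r180 = r180

module _ {m n : ℕ} where

  Rect4-of-InG : ∀ {g} → m ≢ n → InG m n g → Rect4 g
  Rect4-of-InG m≢n (square m≡n _) = ⊥-elim (m≢n m≡n)
  Rect4-of-InG _   (rect _ _ _ r) = r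
  Rect4-of-InG _   (line _ r)     = Rot2⇒Rect4 r
  Rect4-of-InG _   (unit _ _ r)   = Rot2⇒Rect4 r

  Rot2-of-InG : ∀ {g} → m ≡ 1 ⊎ n ≡ 1 → InG m n g → Rot2 g
  Rot2-of-InG (inj₁ refl) (square refl 1<1) = ⊥-elim (<-irrefl refl 1<1)
  Rot2-of-InG (inj₂ refl) (square _ 1<1)    = ⊥-elim (<-irrefl refl 1<1)
  Rot2-of-InG (inj₁ refl) (rect _ 1<1 _ _)  = ⊥-elim (<-irrefl refl 1<1)
  Rot2-of-InG (inj₂ refl) (rect _ _ 1<1 _)  = ⊥-elim (<-irrefl refl 1<1)
  Rot2-of-InG _           (line _ r)        = r
  Rot2-of-InG _           (unit _ _ r)      = r

  InG-∙ : ∀ {g g′} → InG m n g → InG m n g′ → InG m n (g ∙ g′)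
  InG-∙ (square m≡n 1<n)       _  = square m≡n 1<n
  InG-∙ (rect m≢n 1<m 1<n r)   g′G = rect m≢n 1<m 1<n (Rect4-∙ r (Rect4-of-InG m≢n g′G))
  InG-∙ (line (inj₁ thin) r)   g′G = line (inj₁ thin) (Rot2-∙ r (Rot2-of-InG (inj₁ (proj₁ thin)) g′G))
  InG-∙ (line (inj₂ thin) r)   g′G = line (inj₂ thin) (Rot2-∙ r (Rot2-of-InG (inj₂ (proj₂ thin)) g′G))
  InG-∙ (unit m≡1 n≡1 r)       g′G = unit m≡1 n≡1 (Rot2-∙ r (Rot2-of-InG (inj₁ m≡1) g′G))

  InG-inv : ∀ {g} → InG m n g → InG m n (inv g)
  InG-inv (square m≡n 1<n)     = square m≡n 1<n
  InG-inv (rect m≢n 1<m 1<n r) = rect m≢n 1<m 1<n (Rect4-inv r)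
  InG-inv (line thin r)        = line thin (Rot2-inv r)
  InG-inv (unit m≡1 n≡1 r)     = unit m≡1 n≡1 (Rot2-inv r)

  InG-R0 : 1 ≤ m → 1 ≤ n → InG m n R0
  InG-R0 1≤m 1≤n with m ≟ n | m≤n⇒m<n∨m≡n 1≤m | m≤n⇒m<n∨m≡n 1≤n
  ... | yes m≡n | _        | inj₁ 1<n = square m≡n 1<n
  ... | yes m≡n | _        | inj₂ 1≡n = unit (trans m≡n (sym 1≡n)) (sym 1≡n) r0
  ... | no  m≢n | inj₁ 1<m | inj₁ 1<n = rect m≢n 1<m 1<n r0
  ... | no  m≢n | inj₁ 1<m | inj₂ 1≡n = line (inj₂ (1<m , sym 1≡n)) r0
  ... | no  m≢n | inj₂ 1≡m | inj₁ 1<n = line (inj₁ (sym 1≡m , 1<n)) r0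
  ... | no  m≢n | inj₂ 1≡m | inj₂ 1≡n = ⊥-elim (m≢n (trans (sym 1≡m) 1≡n))

opposite? : ∀ {n} → Bool → Fin n → Fin n
opposite? true  i = opposite i
opposite? false i = i

opposite?-xor : ∀ {n} a b (i : Fin n) → opposite? a (opposite? b i) ≡ opposite? (a xor b) i
opposite?-xor true  true  i = opposite-involutive i
opposite?-xor true  false i = refl
opposite?-xor false true  i = refl
opposite?-xor false false i = refl

actˢ : ∀ {m} → PIso → Cell m m → Cell m m
actˢ (false , a , b) (i , j) = opposite? a i , opposite? b j
actˢ (true  , a , b) (i , j) = opposite? a j , opposite? b i

actˢ-∘ᴵ : ∀ {m} σ τ (c : Cell m m) → actˢ (σ ∘ᴵ τ) c ≡ actˢ σ (actˢ τ c)
actˢ-∘ᴵ (false , a , b) (false , a′ , b′) (i , j) =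
  sym (cong₂ _,_ (opposite?-xor a a′ i) (opposite?-xor b b′ j))
actˢ-∘ᴵ (false , a , b) (true  , a′ , b′) (i , j) =
  sym (cong₂ _,_ (opposite?-xor a a′ j) (opposite?-xor b b′ i))
actˢ-∘ᴵ (true  , a , b) (false , a′ , b′) (i , j) =
  sym (cong₂ _,_ (opposite?-xor a b′ j) (opposite?-xor b a′ i))
actˢ-∘ᴵ (true  , a , b) (true  , a′ , b′) (i , j) =
  sym (cong₂ _,_ (opposite?-xor a b′ i) (opposite?-xor b a′ j))

act-square : ∀ {m} g (c : Cell m m) → act g c ≡ actˢ (code g) c
act-square R0   (i , j) = refl
act-square H    (i , j) = refl
act-square V    (i , j) = refl
act-square R180 (i , j) = refl
act-square {m} R90 (i , j) with m ≟ m
... | yes m≡m = cong₂ _,_ (cast-is-id _ j) (cong opposite (cast-is-id m≡m i))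
... | no  m≢m = ⊥-elim (m≢m refl)
act-square {m} R270 (i , j) with m ≟ m
... | yes m≡m = cong₂ _,_ (cast-is-id _ (opposite j)) (cast-is-id m≡m i)
... | no  m≢m = ⊥-elim (m≢m refl)
act-square {m} D (i , j) with m ≟ m
... | yes m≡m = cong₂ _,_ (cast-is-id _ j) (cast-is-id m≡m i)
... | no  m≢m = ⊥-elim (m≢m refl)
act-square {m} A (i , j) with m ≟ m
... | yes m≡m = cong₂ _,_ (cast-is-id _ (opposite j)) (cong opposite (cast-is-id m≡m i))
... | no  m≢m = ⊥-elim (m≢m refl)

act-∙-square : ∀ {m} g g′ (c : Cell m m) → act (g ∙ g′) c ≡ act g (act g′ c)
act-∙-square g g′ c = begin
  act (g ∙ g′) c                    ≡⟨ act-square (g ∙ g′) c ⟩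
  actˢ (code (g ∙ g′)) c            ≡⟨ cong (λ σ → actˢ σ c) (code-∙ g g′) ⟩
  actˢ (code g ∘ᴵ code g′) c        ≡⟨ actˢ-∘ᴵ (code g) (code g′) c ⟩
  actˢ (code g) (actˢ (code g′) c)  ≡⟨ cong (actˢ (code g)) (sym (act-square g′ c)) ⟩
  actˢ (code g) (act g′ c)          ≡⟨ sym (act-square g (act g′ c)) ⟩
  act g (act g′ c)                  ∎
  where open ≡-Reasoning

act-∙-Rect4 : ∀ {m n g g′} → Rect4 g → Rect4 g′ → (c : Cell m n) → act (g ∙ g′) c ≡ act g (act g′ c)
act-∙-Rect4 r0   r0   (i , j) = refl
act-∙-Rect4 r0   h    (i , j) = refl
act-∙-Rect4 r0   v    (i , j) = refl
act-∙-Rect4 r0   r180 (i , j) = refl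
act-∙-Rect4 h    r0   (i , j) = refl
act-∙-Rect4 h    h    (i , j) = cong₂ _,_ (sym (opposite-involutive i)) refl
act-∙-Rect4 h    v    (i , j) = refl
act-∙-Rect4 h    r180 (i , j) = cong₂ _,_ (sym (opposite-involutive i)) refl
act-∙-Rect4 v    r0   (i , j) = refl
act-∙-Rect4 v    h    (i , j) = refl
act-∙-Rect4 v    v    (i , j) = cong₂ _,_ refl (sym (opposite-involutive j))
act-∙-Rect4 v    r180 (i , j) = cong₂ _,_ refl (sym (opposite-involutive j))
act-∙-Rect4 r180 r0   (i , j) = refl
act-∙-Rect4 r180 h    (i , j) = cong₂ _,_ (sym (opposite-involutive i)) refl
act-∙-Rect4 r180 v    (i , j) = cong₂ _,_ refl (sym (opposite-involutive j))
act-∙-Rect4 r180 r180 (i , j) = cong₂ _,_ (sym (opposite-involutive i)) (sym (opposite-involutive j))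

module _ {m n : ℕ} where

  act-∙ : ∀ {g g′} → InG m n g → InG m n g′ → (c : Cell m n) → act (g ∙ g′) c ≡ act g (act g′ c)
  act-∙ {g} {g′} gG g′G c with m ≟ n
  ... | yes refl = act-∙-square g g′ c
  ... | no  m≢n  = act-∙-Rect4 (Rect4-of-InG m≢n gG) (Rect4-of-InG m≢n g′G) c

  act-R0 : (c : Cell m n) → act R0 c ≡ c
  act-R0 (i , j) = refl

  act-act-inv : ∀ {g} → InG m n g → (c : Cell m n) → act g (act (inv g) c) ≡ c
  act-act-inv {g} gG c = begin
    act g (act (inv g) c)   ≡⟨ sym (act-∙ gG (InG-inv gG) c) ⟩
    act (g ∙ inv g) c       ≡⟨ cong (λ g′ → act g′ c) (∙-inverseʳ g) ⟩
    act R0 c                ≡⟨ act-R0 c ⟩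
    c                       ∎
    where open ≡-Reasoning

  act-inv-act : ∀ {g} → InG m n g → (c : Cell m n) → act (inv g) (act g c) ≡ c
  act-inv-act {g} gG c = begin
    act (inv g) (act g c)   ≡⟨ sym (act-∙ (InG-inv gG) gG c) ⟩
    act (inv g ∙ g) c       ≡⟨ cong (λ g′ → act g′ c) (∙-inverseˡ g) ⟩
    act R0 c                ≡⟨ act-R0 c ⟩
    c                       ∎
    where open ≡-Reasoning

  act-inv-injective : ∀ {g c c′} → InG m n g → act (inv g) c ≡ act (inv g) c′ → c ≡ c′
  act-inv-injective {g} {c} {c′} gG eq =
    trans (sym (act-act-inv gG c)) (trans (cong (act g) eq) (act-act-inv gG c′))

vec-ext : ∀ {X : Set} {k} {u w : Vec X k} → (∀ i → lookup u i ≡ lookup w i) → u ≡ w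
vec-ext {u = u} {w} u≗w = trans (sym (tabulate∘lookup u)) (trans (tabulate-cong u≗w) (tabulate∘lookup w))

module _ {m n : ℕ} where

  board-ext : ∀ {b b′ : Board m n} → (∀ c → at b c ≡ at b′ c) → b ≡ b′
  board-ext b≗b′ = vec-ext λ i → vec-ext λ j → b≗b′ (i , j)

  at-actB : ∀ g (b : Board m n) c → at (actB g b) c ≡ at b (act (inv g) c)
  at-actB g b (i , j) = trans (cong (λ row → lookup row j) (lookup∘tabulate _ i)) (lookup∘tabulate _ j)

  actB-∙ : ∀ {g g′} → InG m n g → InG m n g′ → (b : Board m n) → actB g (actB g′ b) ≡ actB (g ∙ g′) b
  actB-∙ {g} {g′} gG g′G b = board-ext λ c → begin
    at (actB g (actB g′ b)) c            ≡⟨ at-actB g (actB g′ b) c ⟩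
    at (actB g′ b) (act (inv g) c)       ≡⟨ at-actB g′ b (act (inv g) c) ⟩
    at b (act (inv g′) (act (inv g) c))  ≡⟨ cong (at b) (sym (act-∙ (InG-inv g′G) (InG-inv gG) c)) ⟩
    at b (act (inv g′ ∙ inv g) c)        ≡⟨ cong (λ x → at b (act x c)) (sym (inv-anti-homo-∙ g g′)) ⟩
    at b (act (inv (g ∙ g′)) c)          ≡⟨ sym (at-actB (g ∙ g′) b c) ⟩
    at (actB (g ∙ g′) b) c               ∎
    where open ≡-Reasoning

  actB-R0 : (b : Board m n) → actB R0 b ≡ b
  actB-R0 b = board-ext λ c → trans (at-actB R0 b c) (cong (at b) (act-R0 c))

  actB-actB-inv : ∀ {g} → InG m n g → (b : Board m n) → actB g (actB (inv g) b) ≡ b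
  actB-actB-inv {g} gG b = begin
    actB g (actB (inv g) b)  ≡⟨ actB-∙ gG (InG-inv gG) b ⟩
    actB (g ∙ inv g) b       ≡⟨ cong (λ x → actB x b) (∙-inverseʳ g) ⟩
    actB R0 b                ≡⟨ actB-R0 b ⟩
    b                        ∎
    where open ≡-Reasoning

  actB-inv-actB : ∀ {g} → InG m n g → (b : Board m n) → actB (inv g) (actB g b) ≡ b
  actB-inv-actB {g} gG b = begin
    actB (inv g) (actB g b)  ≡⟨ actB-∙ (InG-inv gG) gG b ⟩
    actB (inv g ∙ g) b       ≡⟨ cong (λ x → actB x b) (∙-inverseˡ g) ⟩
    actB R0 b                ≡⟨ actB-R0 b ⟩
    b                        ∎
    where open ≡-Reasoning

  IsCount-blocked : (b : Board m n) → IsCount (Cell m n) (Blocked b) (blockedCount b)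
  IsCount-blocked b = IsCount-resp (λ _ → mk⇔ proj₂ (tt ,_))
    (IsCount-filter (λ c → at b c Bool.≟ true) IsCount-allCells)
    where
    IsCount-allCells : IsCount (Cell m n) (λ _ → ⊤) (length (allCells m n))
    IsCount-allCells = allCells m n , Unique.cartesianProduct⁺ (Unique.allFin⁺ m) (Unique.allFin⁺ n) ,
      (λ (i , j) → mk⇔ (λ _ → tt) (λ _ → ∈-cartesianProduct⁺ (∈-allFin i) (∈-allFin j))) , refl

  IsCount-blocked-in-region : ∀ {k} (reg : Cell m n → Fin k) (b : Board m n) a →
    IsCount (Cell m n) (λ c → Blocked b c × reg c ≡ a) (lookup (partition reg b) a)
  IsCount-blocked-in-region reg b a = subst (IsCount _ _) (sym (lookup∘tabulate _ a))
    (IsCount-filter (λ c → reg c Fin.≟ a) (IsCount-blocked b))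

  Blocked-actB : ∀ g (b : Board m n) c → Blocked (actB g b) c ⇔ Blocked b (act (inv g) c)
  Blocked-actB g b c = mk⇔ (trans (sym (at-actB g b c))) (trans (at-actB g b c))

  IsCount-act : ∀ {g N} {P Q : Pred (Cell m n) 0ℓ} → InG m n g →
    (∀ c → P c ⇔ Q (act (inv g) c)) → IsCount (Cell m n) P N → IsCount (Cell m n) Q N
  IsCount-act {g} {Q = Q} gG P⇔Q = IsCount-bijection (act (inv g)) (act g)
    (λ {c} → to (P⇔Q c))
    (λ {c} Qc → from (P⇔Q (act g c)) (subst Q (sym (act-inv-act gG c)) Qc))
    (λ {c} _ → act-act-inv gG c) (λ {c} _ → act-inv-act gG c)

  blockedCount-actB : ∀ {g} → InG m n g → (b : Board m n) → blockedCount (actB g b) ≡ blockedCount b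
  blockedCount-actB {g} gG b =
    IsCount-unique (IsCount-act gG (Blocked-actB g b) (IsCount-blocked (actB g b))) (IsCount-blocked b)

  InB-actB : ∀ {r g} → InG m n g → (b : Board m n) → InB m n r b → InB m n r (actB g b)
  InB-actB gG b = trans (blockedCount-actB gG b)

  region-actB : ∀ {k} {reg : Cell m n → Fin k} → RegionsInvariant m n k reg → ∀ {g} → InG m n g →
    ∀ a → ∃ λ a′ → ∀ c → (reg c ≡ a) ⇔ (reg (act (inv g) c) ≡ a′)
  region-actB {reg = reg} RI {g} gG a with RI (inv g) (InG-inv gG) a
  ... | a′ , image-of-a = a′ , λ c → mk⇔
    (λ c∈a → from (image-of-a _) (c , c∈a , refl))
    (λ g⁻¹c∈a′ → let c₀ , c₀∈a , g⁻¹c₀≡g⁻¹c = to (image-of-a _) g⁻¹c∈a′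
                 in subst (λ c → reg c ≡ a) (act-inv-injective gG g⁻¹c₀≡g⁻¹c) c₀∈a)

  partition-actB : ∀ {k} {reg : Cell m n → Fin k} → RegionsInvariant m n k reg → ∀ {g} → InG m n g →
    ∀ a → ∃ λ a′ → ∀ b → lookup (partition reg (actB g b)) a ≡ lookup (partition reg b) a′
  partition-actB {reg = reg} RI {g} gG a =
    let a′ , region⇔ = region-actB RI gG a
    in a′ , λ b → IsCount-unique
         (IsCount-act gG (λ c → Blocked-actB g b c ×-⇔ region⇔ c)
           (IsCount-blocked-in-region reg (actB g b) a))
         (IsCount-blocked-in-region reg b a′)

  partition-actB-cong : ∀ {k} {reg : Cell m n → Fin k} → RegionsInvariant m n k reg → ∀ {g} → InG m n g →
    ∀ {b b′} → partition reg b ≡ partition reg b′ → partition reg (actB g b) ≡ partition reg (actB g b′)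
  partition-actB-cong RI gG {b} {b′} b≈b′ = vec-ext λ a →
    let a′ , transported = partition-actB RI gG a
    in trans (transported b) (trans (cong (λ u → lookup u a′) b≈b′) (sym (transported b′)))

-- Grid symmetries as isometries of ℤ²

infixl 6 _⊕_
_⊕_ : Point → Point → Point
p ⊕ q = proj₁ p +ℤ proj₁ q , proj₂ p +ℤ proj₂ q

⊕-assoc : ∀ p q s → (p ⊕ q) ⊕ s ≡ p ⊕ (q ⊕ s)
⊕-assoc p q s = cong₂ _,_ (ℤ.+-assoc (proj₁ p) _ _) (ℤ.+-assoc (proj₂ p) _ _)

⊕-cancelʳ : ∀ d {p q} → p ⊕ d ≡ q ⊕ d → p ≡ q
⊕-cancelʳ d eq =
  cong₂ _,_ (∙-cancelʳ (proj₁ d) _ _ (cong proj₁ eq)) (∙-cancelʳ (proj₂ d) _ _ (cong proj₂ eq))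

isometry : Placement → Point → Point
isometry (σ , d) p = pact σ p ⊕ d

neg?-xor : ∀ a b z → neg? (a xor b) z ≡ neg? a (neg? b z)
neg?-xor true  true  z = sym (ℤ.neg-involutive z)
neg?-xor true  false z = refl
neg?-xor false true  z = refl
neg?-xor false false z = refl

neg?-+ : ∀ a z w → neg? a (z +ℤ w) ≡ neg? a z +ℤ neg? a w
neg?-+ true  = ℤ.neg-distrib-+
neg?-+ false z w = refl

neg?-injective : ∀ a {z w} → neg? a z ≡ neg? a w → z ≡ w
neg?-injective true  = ℤ.neg-injective
neg?-injective false eq = eq

pact-∘ᴵ : ∀ σ τ p → pact (σ ∘ᴵ τ) p ≡ pact σ (pact τ p)
pact-∘ᴵ (false , a , b) (false , a′ , b′) (x , y) = cong₂ _,_ (neg?-xor a a′ x) (neg?-xor b b′ y)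
pact-∘ᴵ (false , a , b) (true  , a′ , b′) (x , y) = cong₂ _,_ (neg?-xor a a′ y) (neg?-xor b b′ x)
pact-∘ᴵ (true  , a , b) (false , a′ , b′) (x , y) = cong₂ _,_ (neg?-xor a b′ y) (neg?-xor b a′ x)
pact-∘ᴵ (true  , a , b) (true  , a′ , b′) (x , y) = cong₂ _,_ (neg?-xor a b′ x) (neg?-xor b a′ y)

pact-⊕ : ∀ σ p q → pact σ (p ⊕ q) ≡ pact σ p ⊕ pact σ q
pact-⊕ (false , a , b) (x , y) (x′ , y′) = cong₂ _,_ (neg?-+ a x x′) (neg?-+ b y y′)
pact-⊕ (true  , a , b) (x , y) (x′ , y′) = cong₂ _,_ (neg?-+ a y y′) (neg?-+ b x x′)

pact-injective : ∀ σ {p q} → pact σ p ≡ pact σ q → p ≡ q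
pact-injective (false , a , b) eq =
  cong₂ _,_ (neg?-injective a (cong proj₁ eq)) (neg?-injective b (cong proj₂ eq))
pact-injective (true  , a , b) eq =
  cong₂ _,_ (neg?-injective b (cong proj₂ eq)) (neg?-injective a (cong proj₁ eq))

infixr 9 _∘ᴾ_
_∘ᴾ_ : Placement → Placement → Placement
(σ , d) ∘ᴾ (τ , e) = σ ∘ᴵ τ , isometry (σ , d) e

isometry-∘ᴾ : ∀ T pl p → isometry (T ∘ᴾ pl) p ≡ isometry T (isometry pl p)
isometry-∘ᴾ (σ , d) (τ , e) p = begin
  pact (σ ∘ᴵ τ) p ⊕ (pact σ e ⊕ d)    ≡⟨ cong (_⊕ (pact σ e ⊕ d)) (pact-∘ᴵ σ τ p) ⟩
  pact σ (pact τ p) ⊕ (pact σ e ⊕ d)  ≡⟨ sym (⊕-assoc (pact σ (pact τ p)) (pact σ e) d) ⟩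
  pact σ (pact τ p) ⊕ pact σ e ⊕ d    ≡⟨ cong (_⊕ d) (sym (pact-⊕ σ (pact τ p) e)) ⟩
  pact σ (pact τ p ⊕ e) ⊕ d           ∎
  where open ≡-Reasoning

isometry-injective : ∀ T {p q} → isometry T p ≡ isometry T q → p ≡ q
isometry-injective (σ , d) eq = pact-injective σ (⊕-cancelʳ d eq)

shift : Bool → ℕ → ℤ
shift true  m = + pred m
shift false m = + 0

symPlacement : ℕ → ℕ → PIso → Placement
symPlacement m n (s , a , b) = (s , a , b) , (shift a m , shift b n)

cellPoint-opposite? : ∀ {m} a (i : Fin m) → + toℕ (opposite? a i) ≡ neg? a (+ toℕ i) +ℤ shift a m
cellPoint-opposite? {suc m} true i = sym (begin
  - (+ toℕ i) +ℤ + m   ≡⟨ ℤ.-m+n≡n⊖m (toℕ i) m ⟩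
  m ⊖ toℕ i            ≡⟨ ℤ.⊖-≥ (toℕ≤pred[n] i) ⟩
  + (m ∸ toℕ i)        ≡⟨ cong +_ (sym (opposite-prop i)) ⟩
  + toℕ (opposite i)   ∎)
  where open ≡-Reasoning
cellPoint-opposite? false i = sym (ℤ.+-identityʳ (+ toℕ i))

module _ {m n : ℕ} where

  cellPoint-flip : ∀ a b (i : Fin m) (j : Fin n) →
    cellPoint {m} {n} (opposite? a i , opposite? b j)
      ≡ isometry (symPlacement m n (false , a , b)) (cellPoint (i , j))
  cellPoint-flip a b i j = cong₂ _,_ (cellPoint-opposite? a i) (cellPoint-opposite? b j)

  cellPoint-act-Rect4 : ∀ {g} → Rect4 g → (c : Cell m n) →
    cellPoint (act g c) ≡ isometry (symPlacement m n (code g)) (cellPoint c)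
  cellPoint-act-Rect4 r0   (i , j) = cellPoint-flip false false i j
  cellPoint-act-Rect4 h    (i , j) = cellPoint-flip true  false i j
  cellPoint-act-Rect4 v    (i , j) = cellPoint-flip false true  i j
  cellPoint-act-Rect4 r180 (i , j) = cellPoint-flip true  true  i j

cellPoint-actˢ : ∀ {m} σ (c : Cell m m) →
  cellPoint (actˢ σ c) ≡ isometry (symPlacement m m σ) (cellPoint c)
cellPoint-actˢ (false , a , b) (i , j) = cellPoint-flip a b i j
cellPoint-actˢ (true  , a , b) (i , j) = cong₂ _,_ (cellPoint-opposite? a j) (cellPoint-opposite? b i)

module _ {m n : ℕ} where

  cellPoint-act : ∀ {g} → InG m n g → (c : Cell m n) →
    cellPoint (act g c) ≡ isometry (symPlacement m n (code g)) (cellPoint c)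
  cellPoint-act {g} gG c with m ≟ n
  ... | yes refl = trans (cong cellPoint (act-square g c)) (cellPoint-actˢ (code g) c)
  ... | no  m≢n  = cellPoint-act-Rect4 (Rect4-of-InG m≢n gG) c

concat-zipWith-∘ᴾ : ∀ T pls pieces →
  concat (zipWith place (map (T ∘ᴾ_) pls) pieces) ≡ map (isometry T) (concat (zipWith place pls pieces))
concat-zipWith-∘ᴾ T []         pieces   = refl
concat-zipWith-∘ᴾ T (pl ∷ pls) []       = refl
concat-zipWith-∘ᴾ T (pl ∷ pls) (P ∷ Ps) = begin
  map (isometry (T ∘ᴾ pl)) P ++ concat (zipWith place (map (T ∘ᴾ_) pls) Ps)
    ≡⟨ cong₂ _++_ (trans (map-cong (isometry-∘ᴾ T pl) P) (map-∘ P)) (concat-zipWith-∘ᴾ T pls Ps) ⟩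
  map (isometry T) (map (isometry pl) P) ++ map (isometry T) (concat (zipWith place pls Ps))
    ≡⟨ sym (map-++ (isometry T) (map (isometry pl) P) _) ⟩
  map (isometry T) (map (isometry pl) P ++ concat (zipWith place pls Ps))
    ∎
  where open ≡-Reasoning

module _ {m n : ℕ} where

  FreePoint : Board m n → Point → Set
  FreePoint b z = Σ (Cell m n) λ c → cellPoint c ≡ z × at b c ≡ false

  Solvable-actB : ∀ {g} → InG m n g → (pieces : List (List Point)) (b : Board m n) →
    Solvable pieces b → Solvable pieces (actB g b)
  Solvable-actB {g} gG pieces b (pls , #pls , tiles! , tiles⇔) =
    map (T ∘ᴾ_) pls , trans (length-map _ pls) #pls ,
    subst Unique (sym moved) (Unique.map⁺ (isometry-injective T) tiles!) ,
    λ z → mk⇔ (λ z∈ → covered (subst (z ∈_) moved z∈)) (λ free → subst (z ∈_) (sym moved) (covers free))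
    where
    T : Placement
    T = symPlacement m n (code g)

    tiles : List Point
    tiles = concat (zipWith place pls pieces)

    moved : concat (zipWith place (map (T ∘ᴾ_) pls) pieces) ≡ map (isometry T) tiles
    moved = concat-zipWith-∘ᴾ T pls pieces

    covered : ∀ {z} → z ∈ map (isometry T) tiles → FreePoint (actB g b) z
    covered z∈ with ∈-map⁻ (isometry T) z∈
    ... | w , w∈ , z≡Tw with to (tiles⇔ w) w∈
    ...   | c , c↦w , free =
      act g c ,
      trans (cellPoint-act gG c) (trans (cong (isometry T) c↦w) (sym z≡Tw)) ,
      trans (at-actB g b (act g c)) (trans (cong (at b) (act-inv-act gG c)) free)

    covers : ∀ {z} → FreePoint (actB g b) z → z ∈ map (isometry T) tiles
    covers (c , c↦z , free) =
      subst (_∈ map (isometry T) tiles)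
        (trans (sym (cellPoint-act gG (act (inv g) c))) (trans (cong cellPoint (act-act-inv gG c)) c↦z))
        (∈-map⁺ (isometry T) (from (tiles⇔ _) (act (inv g) c , refl , trans (sym (at-actB g b c)) free)))

-- Orbits of the classes π i

_≟ᴮ_ : ∀ {m n} → DecidableEquality (Board m n)
_≟ᴮ_ = Vec.≡-dec (Vec.≡-dec Bool._≟_)

module OrbitCounting {m n k t : ℕ} (r : ℕ) {reg : Cell m n → Fin k} (RI : RegionsInvariant m n k reg)
                     (p : Fin t → Vec ℕ k) where

  π : Fin t → Board m n → Set
  π i b = InB m n r b × partition reg b ≡ p i

  π? : ∀ i → Decidable (π i)
  π? i b = (blockedCount b ℕ.≟ r) ×-dec Vec.≡-dec ℕ._≟_ (partition reg b) (p i)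

  Stabilises : Fin t → Sym → Set
  Stabilises i g = ∀ b′ → (Σ (Board m n) λ b → π i b × actB g b ≡ b′) ⇔ π i b′

  Stabilises-R0 : ∀ i → Stabilises i R0
  Stabilises-R0 i b′ = mk⇔ (λ (b , πb , b≡b′) → subst (π i) (trans (sym (actB-R0 b)) b≡b′) πb)
                          (λ πb′ → b′ , πb′ , actB-R0 b′)

  π-actB : ∀ {i g b b′} → InG m n g → π i b → π i (actB g b) → π i b′ → π i (actB g b′)
  π-actB {g = g} {b} {b′} gG (_ , b∈i) (_ , gb∈i) (InB-b′ , b′∈i) =
    InB-actB gG b′ InB-b′ ,
    trans (partition-actB-cong RI gG {b′} {b} (trans b′∈i (sym b∈i))) gb∈i

  stabilises-π : ∀ {i g b} → InG m n g → π i b → π i (actB g b) → Stabilises i g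
  stabilises-π {i} {g} {b} gG πb πgb b′ = mk⇔
    (λ (b″ , πb″ , gb″≡b′) → subst (π i) gb″≡b′ (π-actB {i} {g} {b} {b″} gG πb πgb πb″))
    (λ πb′ → actB (inv g) b′ ,
             π-actB {i} {inv g} {actB g b} {b′} (InG-inv gG) πgb
                    (subst (π i) (sym (actB-inv-actB gG b)) πb) πb′ ,
             actB-actB-inv gG b′)

  InOrbit : Fin t → Board m n → Set
  InOrbit i x = ∃ λ g → InG m n g × π i (actB (inv g) x)

  InOrbit? : ∀ {gs} → IsCount Sym (InG m n) gs → ∀ i → Decidable (InOrbit i)
  InOrbit? #G i x = IsCount-any? #G (λ g → π? i (actB (inv g) x))

  InOrbit-actB : ∀ {i g b} → InG m n g → π i b → InOrbit i (actB g b)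
  InOrbit-actB {i} {g} {b} gG πb = g , gG , subst (π i) (sym (actB-inv-actB gG b)) πb

  module _ (Bbar : Board m n → Set) (Bbar⇔π : ∀ b → Bbar b ⇔ (∃ λ i → π i b)) where

    InOrbit-cover : (∀ x → InB m n r x → Σ (Board m n) λ b → Bbar b × Equiv b x) →
                    ∀ {x} → InB m n r x → ∃ λ i → InOrbit i x
    InOrbit-cover Bbar-complete {x} InB-x with Bbar-complete x InB-x
    ... | b , b∈Bbar , g , gG , gb≡x with to (Bbar⇔π b) b∈Bbar
    ...   | i , πb = i , subst (InOrbit i) gb≡x (InOrbit-actB {i} {g} {b} gG πb)

    InOrbit-unique : (∀ i j b → π i b → π j b → i ≡ j) →
                     (∀ b b′ → Bbar b → Bbar b′ → Equiv b b′ → partition reg b ≡ partition reg b′) →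
                     ∀ {x i j} → InOrbit i x → InOrbit j x → i ≡ j
    InOrbit-unique π-disjoint Bbar-partition {x} {i} {j} (g₁ , g₁G , πb₁) (g₂ , g₂G , πb₂) =
      π-disjoint i j b₁ πb₁ (proj₁ πb₁ , trans same-partition (proj₂ πb₂))
      where
      b₁ b₂ : Board m n
      b₁ = actB (inv g₁) x
      b₂ = actB (inv g₂) x

      b₁~b₂ : Equiv b₁ b₂
      b₁~b₂ = inv g₂ ∙ g₁ , InG-∙ (InG-inv g₂G) g₁G , (begin
        actB (inv g₂ ∙ g₁) b₁         ≡⟨ sym (actB-∙ (InG-inv g₂G) g₁G b₁) ⟩
        actB (inv g₂) (actB g₁ b₁)    ≡⟨ cong (actB (inv g₂)) (actB-actB-inv g₁G x) ⟩
        b₂                            ∎)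
        where open ≡-Reasoning

      same-partition : partition reg b₁ ≡ partition reg b₂
      same-partition =
        Bbar-partition b₁ b₂ (from (Bbar⇔π b₁) (i , πb₁)) (from (Bbar⇔π b₂) (j , πb₂)) b₁~b₂

  module _ (pieces : List (List Point)) where

    Fibre : Fin t → Board m n → Sym × Board m n → Set
    Fibre i y (g , b) = (InG m n g × (π i b × Solvable pieces b)) × actB g b ≡ y

    IsCount-Fibre : ∀ {i y κ} → IsCount Sym (InG m n ∩ Stabilises i) κ →
                    Solvable pieces y → InOrbit i y → IsCount (Sym × Board m n) (Fibre i y) κ
    IsCount-Fibre {i} {y} #K solvable-y (g₀ , g₀G , πb₀) =
      IsCount-bijection {P = InG m n ∩ Stabilises i} {Q = Fibre i y}
        to-fibre from-fibre in-fibre (λ {a} → stabilising {a})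
        (λ {k} _ → inv-∙-cancel g₀ k)
        (λ {(g , b)} ((gG , _) , gb≡y) → cong₂ _,_ (∙-inv-cancel g₀ g) (back-to-b {g} {b} gG gb≡y))
        #K
      where
      b₀ : Board m n
      b₀ = actB (inv g₀) y

      to-fibre : Sym → Sym × Board m n
      to-fibre k = g₀ ∙ k , actB (inv k) b₀

      from-fibre : Sym × Board m n → Sym
      from-fibre (g , _) = inv g₀ ∙ g

      moves-to-b₀ : ∀ {g b} → InG m n g → actB g b ≡ y → actB (inv g₀ ∙ g) b ≡ b₀
      moves-to-b₀ {g} {b} gG gb≡y = trans (sym (actB-∙ (InG-inv g₀G) gG b)) (cong (actB (inv g₀)) gb≡y)

      back-to-b : ∀ {g b} → InG m n g → actB g b ≡ y → actB (inv (inv g₀ ∙ g)) b₀ ≡ b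
      back-to-b {g} {b} gG gb≡y =
        trans (cong (actB (inv (inv g₀ ∙ g))) (sym (moves-to-b₀ {g} {b} gG gb≡y)))
              (actB-inv-actB (InG-∙ (InG-inv g₀G) gG) b)

      in-fibre : ∀ {k} → (InG m n ∩ Stabilises i) k → Fibre i y (to-fibre k)
      in-fibre {k} (kG , k-stabilises) with from (k-stabilises b₀) πb₀
      ... | b , πb , kb≡b₀ =
        (InG-∙ g₀G kG ,
         subst (π i) b≡k⁻¹b₀ πb ,
         Solvable-actB (InG-inv kG) pieces b₀ (Solvable-actB (InG-inv g₀G) pieces y solvable-y)) ,
        (begin
          actB (g₀ ∙ k) (actB (inv k) b₀)      ≡⟨ sym (actB-∙ g₀G kG (actB (inv k) b₀)) ⟩
          actB g₀ (actB k (actB (inv k) b₀))   ≡⟨ cong (actB g₀) (actB-actB-inv kG b₀) ⟩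
          actB g₀ b₀                           ≡⟨ actB-actB-inv g₀G y ⟩
          y                                    ∎)
        where
        open ≡-Reasoning
        b≡k⁻¹b₀ : b ≡ actB (inv k) b₀
        b≡k⁻¹b₀ = trans (sym (actB-inv-actB kG b)) (cong (actB (inv k)) kb≡b₀)

      stabilising : ∀ {a} → Fibre i y a → (InG m n ∩ Stabilises i) (from-fibre a)
      stabilising {g , b} ((gG , πb , _) , gb≡y) =
        InG-∙ (InG-inv g₀G) gG ,
        stabilises-π {i} {inv g₀ ∙ g} {b} (InG-∙ (InG-inv g₀G) gG) πb
          (subst (π i) (sym (moves-to-b₀ {g} {b} gG gb≡y)) πb₀)

    orbit-count : ∀ {i gs sᵢ κ nᵢ} → IsCount Sym (InG m n) gs →
      IsCount (Board m n) (λ b → π i b × Solvable pieces b) sᵢ →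
      IsCount Sym (InG m n ∩ Stabilises i) κ →
      IsCount (Board m n) ((λ b → InB m n r b × Solvable pieces b) ∩ InOrbit i) nᵢ →
      gs * sᵢ ≡ nᵢ * κ
    orbit-count {i} {κ = κ} #G #S #K #orbit =
      IsCount-fibres κ _≟ᴮ_ (λ (g , b) → actB g b) (IsCount-× #G #S) #orbit
        (λ {(g , b)} (gG , πb , solvable-b) →
          (InB-actB gG b (proj₁ πb) , Solvable-actB gG pieces b solvable-b) ,
          InOrbit-actB {i} {g} {b} gG πb)
        (λ ((_ , solvable-y) , y∈orbit) → IsCount-Fibre #K solvable-y y∈orbit)

∑≡sum-allFin : ∀ t (c : Fin t → ℕ) → ∑ t c ≡ sum (map c (allFin t))
∑≡sum-allFin t c = trans (∑≡sum-tabulate t c) (cong sum (sym (map-tabulate id c)))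
  where
  ∑≡sum-tabulate : ∀ t (c : Fin t → ℕ) → ∑ t c ≡ sum (tabulate c)
  ∑≡sum-tabulate zero    c = refl
  ∑≡sum-tabulate (suc t) c = cong (_+_ (c zero)) (∑≡sum-tabulate t (c ∘ suc))

κ*d*s≡n*κ⇒n≡s*d : ∀ κ d s n .{{_ : NonZero κ}} → κ * d * s ≡ n * κ → n ≡ s * d
κ*d*s≡n*κ⇒n≡s*d κ d s n κ*d*s≡n*κ = *-cancelʳ-≡ n (s * d) κ (begin
  n * κ        ≡⟨ sym κ*d*s≡n*κ ⟩
  κ * d * s    ≡⟨ *-comm (κ * d) s ⟩
  s * (κ * d)  ≡⟨ cong (s *_) (*-comm κ d) ⟩
  s * (d * κ)  ≡⟨ sym (*-assoc s d κ) ⟩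
  s * d * κ    ∎)
  where open ≡-Reasoning

corollary3p2 :
  (m n r : ℕ) → 1 ≤ m → 1 ≤ n → 1 ≤ r → r ≤ m * n →
  -- division of the grid into k regions, invariant under G
  (k : ℕ) (reg : Cell m n → Fin k) → RegionsInvariant m n k reg →
  -- the tiling problem: a list of polyominoes of total area mn - r
  (pieces : List (List Point)) → All IsPolyomino pieces →
  sum (map area pieces) + r ≡ m * n →
  -- B̄ ⊆ 𝓑(m,n;r) and the classes π_1..π_t (π_i = boards with partition p i)
  (Bbar : Board m n → Set) (t : ℕ) (p : Fin t → Vec ℕ k) →
  let π : Fin t → Board m n → Set
      π i b = InB m n r b × partition reg b ≡ p i in
  -- (1) B̄ is the disjoint union of π_1, …, π_t
  (∀ b → Bbar b ⇔ Σ (Fin t) λ i → π i b) →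
  (∀ i j b → π i b → π j b → i ≡ j) →
  -- (2) every board of 𝓑(m,n;r) is equivalent to one of B̄
  (∀ b → InB m n r b → Σ (Board m n) λ b' → Bbar b' × Equiv b' b) →
  -- (3) equivalent boards of B̄ have the same board partition
  (∀ b b' → Bbar b → Bbar b' → Equiv b b' → partition reg b ≡ partition reg b') →
  -- counts: N = #solvable boards in 𝓑(m,n;r), s i = |S_i|,
  -- κ i = |K_i|, gs = |G|, d i = [G : K_i] = |G| / |K_i|
  (N gs : ℕ) (s κ d : Fin t → ℕ) →
  IsCount (Board m n) (λ b → InB m n r b × Solvable pieces b) N →
  (∀ i → IsCount (Board m n) (λ b → π i b × Solvable pieces b) (s i)) →
  IsCount Sym (InG m n) gs →
  (∀ i → IsCount Sym (λ g → InG m n g ×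
                        (∀ b' → (Σ (Board m n) λ b → π i b × actB g b ≡ b') ⇔ π i b'))
                 (κ i)) →
  (∀ i → κ i * d i ≡ gs) →
  N ≡ ∑ t (λ i → s i * d i)
corollary3p2 m n r 1≤m 1≤n _ _ k reg RI pieces _ _ Bbar t p
             Bbar⇔π π-disjoint Bbar-complete Bbar-partition N gs s κ d #solvable #S #G #K κ*d≡gs =
  begin
    N
      ≡⟨ IsCount-partition (InOrbit? #G) #solvable (allFin t) (Unique.allFin⁺ t)
           (λ {b} (InB-b , _) → let i , b∈orbit = InOrbit-cover Bbar Bbar⇔π Bbar-complete {b} InB-b
                                in i , ∈-allFin i , b∈orbit)
           (λ {b} _ → InOrbit-unique Bbar Bbar⇔π π-disjoint Bbar-partition {b})
           (λ i → s i * d i) (λ {i} _ → #orbit i) ⟩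
    sum (map (λ i → s i * d i) (allFin t))
      ≡⟨ sym (∑≡sum-allFin t (λ i → s i * d i)) ⟩
    ∑ t (λ i → s i * d i)
      ∎
  where
  open ≡-Reasoning
  open OrbitCounting r RI p

  #orbit : ∀ i → IsCount (Board m n) ((λ b → InB m n r b × Solvable pieces b) ∩ InOrbit i) (s i * d i)
  #orbit i =
    let nᵢ , _ , #orbitᵢ , _ = IsCount-split (InOrbit? #G i) #solvable
        1∈Kᵢ = InG-R0 1≤m 1≤n , Stabilises-R0 i
    in subst (IsCount _ _)
         (κ*d*s≡n*κ⇒n≡s*d (κ i) (d i) (s i) nᵢ {{IsCount-nonZero (#K i) 1∈Kᵢ}}
           (trans (cong (_* s i) (κ*d≡gs i)) (orbit-count pieces #G (#S i) (#K i) #orbitᵢ)))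
         #orbitᵢ
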